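{- Let $\mathcal{M}_1$ and $\mathcal{M}_2$ be quasi-discrete neighbourhood models and $\rho$ a modal bisimulation with converse between them with $x_1\rho x_2$. Then for every SLCS formula $\varphi$, $\mathcal{M}_1,x_1\models\varphi$ if and only if $\mathcal{M}_2,x_2\models\varphi$.
   Context: A neighbourhood space $(X,\mathcal{N})$ assigns to each $x\in X$ a filter $\mathcal{N}(x)$ on $X$ (closed under non-empty finite intersections and supersets, $\emptyset\notin\mathcal{N}(x)$) with $x\in N$ for all $N\in\mathcal{N}(x)$. It is quasi-discrete if every $x$ has a minimal neighbourhood $\mathcal{N}_{\min}(x)$. Closure: $\mathcal{C}(A)=\{x\mid\forall N\in\mathcal{N}(x):A\cap N\ne\emptyset\}$. A quasi-discrete neighbourhood model $(X,\mathcal{N},V)$ is a quasi-discrete space with valuation $V:X\to\mathcal{P}(\mathsf{P})$ and index space $\mathbb{N}$ (usual order, least element $0$, minimal neighbourhood of $n$ is $\{n,n+1\}$); paths are continuous maps $p:\mathbb{N}\to X$, i.e. maps with $p(n+1)\in\mathcal{N}_{\min}(p(n))$ for all $n$. Induced edge relation $R=\{(x,y)\mid y\in\mathcal{N}_{\min}(x)\}$. A relation $\rho\subseteq X_1\times X_2$ is a modal bisimulation if for every $x_1\rho x_2$: $V_1(x_1)=V_2(x_2)$; if $(x_1,y_1)\in R_1$ then there is $y_2$ with $(x_2,y_2)\in R_2$ and $y_1\rho y_2$; if $(x_2,y_2)\in R_2$ then there is $y_1$ with $(x_1,y_1)\in R_1$ and $y_1\rho y_2$. It is a modal bisimulation with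 converse if additionally for every $x_1\rho x_2$: if $(y_1,x_1)\in R_1$ there is $y_2$ with $(y_2,x_2)\in R_2$ and $y_1\rho y_2$; if $(y_2,x_2)\in R_2$ there is $y_1$ with $(y_1,x_1)\in R_1$ and $y_1\rho y_2$. SLCS formulas: $\varphi::=a\mid\top\mid\neg\varphi\mid\varphi\wedge\varphi\mid\mathcal{N}\varphi\mid\varphi\,\mathcal{R}\,\varphi\mid\varphi\,\mathcal{P}\,\varphi$ ($a\in\mathsf{P}$). Semantics: $x\models a$ iff $a\in V(x)$; $\top$ always; Booleans as usual; $x\models\mathcal{N}\varphi$ iff $x\in\mathcal{C}(\{y\mid y\models\varphi\})$; $x\models\varphi\,\mathcal{R}\,\psi$ iff there are a path $p$ and $n$ with $p(n)=x$, $p(0)\models\psi$, and $p(i)\models\varphi$ for all $0<i\le n$; $x\models\varphi\,\mathcal{P}\,\psi$ iff there are a path $p$ with $p(0)=x$ and $n$ with $p(n)\models\psi$ and $p(i)\models\varphi$ for all $0\le i<n$. -}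

module Defs where

open import Data.Nat using (ℕ; zero; suc; _<_; _≤_)
open import Data.Product using (Σ; ∃; _×_; _,_)
open import Data.Empty using (⊥)
open import Data.Unit.Polymorphic using (⊤)
import Level
open import Level using (Lift)
open import Relation.Nullary using (¬_)
open import Relation.Binary.PropositionalEquality using (_≡_)
open import Function.Bundles using (_⇔_)

Subset : Set → Set₁
Subset X = X → Set

_⊆_ : {X : Set} → Subset X → Subset X → Set
A ⊆ B = ∀ x → A x → B x

_∩_ : {X : Set} → Subset X → Subset X → Subset X
(A ∩ B) x = A x × B x

record QDModel (P : Set) : Set₂ where
  field
    X        : Set
    𝒩        : X → Subset X → Set
    ∩-closed : ∀ x A B → 𝒩 x A → 𝒩 x B → 𝒩 x (A ∩ B)
    ⊇-closed : ∀ x A B → 𝒩 x A → A ⊆ B → 𝒩 x B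
    ∅-notin  : ∀ x → ¬ 𝒩 x (λ _ → ⊥)
    self∈    : ∀ x A → 𝒩 x A → A x
    -- quasi-discreteness: a minimal neighbourhood exists for every point
    𝒩min     : X → Subset X
    𝒩min∈    : ∀ x → 𝒩 x (𝒩min x)
    𝒩min-min : ∀ x A → 𝒩 x A → 𝒩min x ⊆ A
    V        : X → Subset P

  -- closure operator
  -- (A is given as a Set₁-valued predicate so that it can be a satisfaction set)
  𝒞 : (X → Set₁) → X → Set₁
  𝒞 A x = ∀ N → 𝒩 x N → Σ X λ y → A y × N y

  -- paths: continuous maps from the index space ℕ (min. nbhd of n is {n, n+1})
  IsPath : (ℕ → X) → Set
  IsPath p = ∀ n → 𝒩min (p n) (p (suc n))

  R : X → X → Set
  R x y = 𝒩min x y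

data Formula (P : Set) : Set where
  atom : P → Formula P
  tt   : Formula P
  ¬'_  : Formula P → Formula P
  _∧'_ : Formula P → Formula P → Formula P
  𝓝    : Formula P → Formula P
  _𝓡_  : Formula P → Formula P → Formula P
  _𝓟_  : Formula P → Formula P → Formula P

module _ {P : Set} (M : QDModel P) where
  open QDModel M

  -- satisfaction lives in Set₁ since 𝒞 quantifies over all subsets
  _⊨_ : X → Formula P → Set₁
  x ⊨ atom a  = Lift (Level.suc Level.zero) (V x a)
  x ⊨ tt      = ⊤
  x ⊨ (¬' φ)  = ¬ (x ⊨ φ)
  x ⊨ (φ ∧' ψ) = (x ⊨ φ) × (x ⊨ ψ)
  x ⊨ 𝓝 φ     = 𝒞 (λ y → y ⊨ φ) x
  x ⊨ (φ 𝓡 ψ) = Σ (ℕ → X) λ p → Lift (Level.suc Level.zero) (IsPath p) × Σ ℕ λ n →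
                   Lift (Level.suc Level.zero) (p n ≡ x) × (p 0 ⊨ ψ) × (∀ i → 0 < i → i ≤ n → p i ⊨ φ)
  x ⊨ (φ 𝓟 ψ) = Σ (ℕ → X) λ p → Lift (Level.suc Level.zero) (IsPath p) × Lift (Level.suc Level.zero) (p 0 ≡ x) × Σ ℕ λ n →
                   (p n ⊨ ψ) × (∀ i → i < n → p i ⊨ φ)

record IsModalBisimConv {P : Set} (M₁ M₂ : QDModel P)
    (ρ : QDModel.X M₁ → QDModel.X M₂ → Set) : Set₁ where
  module M₁ = QDModel M₁
  module M₂ = QDModel M₂
  field
    val   : ∀ {x₁ x₂} → ρ x₁ x₂ → ∀ a → M₁.V x₁ a ⇔ M₂.V x₂ a
    zig   : ∀ {x₁ x₂} → ρ x₁ x₂ → ∀ y₁ → M₁.R x₁ y₁ → Σ M₂.X λ y₂ → M₂.R x₂ y₂ × ρ y₁ y₂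
    zag   : ∀ {x₁ x₂} → ρ x₁ x₂ → ∀ y₂ → M₂.R x₂ y₂ → Σ M₁.X λ y₁ → M₁.R x₁ y₁ × ρ y₁ y₂
    zigᶜ  : ∀ {x₁ x₂} → ρ x₁ x₂ → ∀ y₁ → M₁.R y₁ x₁ → Σ M₂.X λ y₂ → M₂.R y₂ x₂ × ρ y₁ y₂
    zagᶜ  : ∀ {x₁ x₂} → ρ x₁ x₂ → ∀ y₂ → M₂.R y₂ x₂ → Σ M₁.X λ y₁ → M₁.R y₁ x₁ × ρ y₁ y₂

module Submission where

-- The proof is an induction on the formula, proving only the forward
-- implication M₁, x₁ ⊨ φ ⇒ M₂, x₂ ⊨ φ; the backward implication (and the
-- negation case of the induction) use the same statement for the converse
-- relation, which is again a modal bisimulation with converse.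
-- Two facts carry the non-Boolean cases:
--  * in a quasi-discrete space, x lies in the closure of A iff some
--    R-successor of x lies in A, so 𝓝 only talks about edges (zig);
--  * every path p of M₁ with ρ (p n) x₂ is "traced" by a path q of M₂ with
--    q n ≡ x₂ and ρ (p i) (q i) for all i: from time 0 onwards q is built by
--    following p forwards (zig), and the prefix before n is built by
--    following p backwards (zigᶜ). This serves both 𝓡 (n arbitrary) and
--    𝓟 (n = 0).

open import Defs
open import Function.Base using (_∘_)
open import Function.Bundles using (_⇔_; mk⇔; Equivalence)
open import Data.Nat using (ℕ; zero; suc)
open import Data.Product using (Σ; _×_; _,_; proj₁; proj₂)
open import Level using (lift; lower)
open import Relation.Binary.PropositionalEquality using (_≡_; refl; subst; sym)

module _ {P : Set} (M : QDModel P) where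
  open QDModel M

  -- The minimal neighbourhood witnesses closure: a point of A near x can
  -- always be found among the R-successors of x ...
  closure⇒successor : ∀ {A : X → Set₁} {x} → 𝒞 A x → Σ X λ y → R x y × A y
  closure⇒successor {x = x} x∈𝒞A with x∈𝒞A (𝒩min x) (𝒩min∈ x)
  ... | y , Ay , Rxy = y , Rxy , Ay

  successor⇒closure : ∀ {A : X → Set₁} {x y} → R x y → A y → 𝒞 A x
  successor⇒closure {x = x} {y} Rxy Ay N N∈𝒩x = y , Ay , 𝒩min-min x N N∈𝒩x y Rxy

converse : {P : Set} {M₁ M₂ : QDModel P} {ρ : QDModel.X M₁ → QDModel.X M₂ → Set} →
  IsModalBisimConv M₁ M₂ ρ → IsModalBisimConv M₂ M₁ (λ x₂ x₁ → ρ x₁ x₂)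
converse B = record
  { val  = λ r a → mk⇔ (Equivalence.from (val r a)) (Equivalence.to (val r a))
  ; zig  = zag
  ; zag  = zig
  ; zigᶜ = zagᶜ
  ; zagᶜ = zigᶜ
  }
  where open IsModalBisimConv B

module PathTracing {P : Set} {M₁ M₂ : QDModel P}
    {ρ : QDModel.X M₁ → QDModel.X M₂ → Set} (B : IsModalBisimConv M₁ M₂ ρ) where
  private
    module M₁ = QDModel M₁
    module M₂ = QDModel M₂
  open IsModalBisimConv B using (zig; zigᶜ)

  Trace : (ℕ → M₁.X) → ℕ → M₂.X → Set
  Trace p n x₂ = Σ (ℕ → M₂.X) λ q → M₂.IsPath q × q n ≡ x₂ × (∀ i → ρ (p i) (q i))

  trace-forward : ∀ p → M₁.IsPath p → ∀ {x₂} → ρ (p 0) x₂ → Trace p 0 x₂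
  trace-forward p p-path {x₂} r₀ = proj₁ ∘ partner , q-path , refl , proj₂ ∘ partner
    where
    partner : ∀ i → Σ M₂.X (ρ (p i))
    next : ∀ i → Σ M₂.X λ y → M₂.R (proj₁ (partner i)) y × ρ (p (suc i)) y
    partner zero    = x₂ , r₀
    partner (suc i) = proj₁ (next i) , proj₂ (proj₂ (next i))
    next i = zig (proj₂ (partner i)) (p (suc i)) (p-path i)

    q-path : M₂.IsPath (proj₁ ∘ partner)
    q-path i = proj₁ (proj₂ (next i))

  trace-extend : ∀ p → M₁.IsPath p → ∀ {n x₂} → Trace (p ∘ suc) n x₂ → Trace p (suc n) x₂
  trace-extend p p-path (q , q-path , qn≡x₂ , q-link) with zigᶜ (q-link 0) (p 0) (p-path 0)
  ... | y , Ryq₀ , r₀ = q′ , q′-path , qn≡x₂ , q′-link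
    where
    q′ : ℕ → M₂.X
    q′ zero    = y
    q′ (suc i) = q i
    q′-path : M₂.IsPath q′
    q′-path zero    = Ryq₀
    q′-path (suc i) = q-path i
    q′-link : ∀ i → ρ (p i) (q′ i)
    q′-link zero    = r₀
    q′-link (suc i) = q-link i

  trace : ∀ n p → M₁.IsPath p → ∀ {x₂} → ρ (p n) x₂ → Trace p n x₂
  trace zero    p p-path r = trace-forward p p-path r
  trace (suc n) p p-path r = trace-extend p p-path (trace n (p ∘ suc) (p-path ∘ suc) r)

preserve : {P : Set} {M₁ M₂ : QDModel P} {ρ : QDModel.X M₁ → QDModel.X M₂ → Set} →
  IsModalBisimConv M₁ M₂ ρ → ∀ {x₁ x₂} → ρ x₁ x₂ → (φ : Formula P) →
  _⊨_ M₁ x₁ φ → _⊨_ M₂ x₂ φ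
preserve B r (atom a) x₁⊨a = lift (Equivalence.to (IsModalBisimConv.val B r a) (lower x₁⊨a))
preserve B r tt _ = _
preserve B r (¬' φ) x₁⊭φ x₂⊨φ = x₁⊭φ (preserve (converse B) r φ x₂⊨φ)
preserve B r (φ ∧' ψ) (x₁⊨φ , x₁⊨ψ) = preserve B r φ x₁⊨φ , preserve B r ψ x₁⊨ψ
preserve {M₁ = M₁} {M₂} B r (𝓝 φ) x₁⊨𝓝φ with closure⇒successor M₁ x₁⊨𝓝φ
... | y₁ , R₁x₁y₁ , y₁⊨φ with IsModalBisimConv.zig B r y₁ R₁x₁y₁
... | y₂ , R₂x₂y₂ , r′ = successor⇒closure M₂ R₂x₂y₂ (preserve B r′ φ y₁⊨φ)
preserve {ρ = ρ} B {x₂ = x₂} r (φ 𝓡 ψ) (p , lift p-path , n , lift pn≡x₁ , p0⊨ψ , p⊨φ)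
  with PathTracing.trace B n p p-path (subst (λ z → ρ z x₂) (sym pn≡x₁) r)
... | q , q-path , qn≡x₂ , link =
  q , lift q-path , n , lift qn≡x₂ , preserve B (link 0) ψ p0⊨ψ ,
  λ i 0<i i≤n → preserve B (link i) φ (p⊨φ i 0<i i≤n)
preserve {ρ = ρ} B {x₂ = x₂} r (φ 𝓟 ψ) (p , lift p-path , lift p0≡x₁ , n , pn⊨ψ , p⊨φ)
  with PathTracing.trace B 0 p p-path (subst (λ z → ρ z x₂) (sym p0≡x₁) r)
... | q , q-path , q0≡x₂ , link =
  q , lift q-path , lift q0≡x₂ , n , preserve B (link n) ψ pn⊨ψ ,
  λ i i<n → preserve B (link i) φ (p⊨φ i i<n)

theorem29 : {P : Set} (M₁ M₂ : QDModel P)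
    (ρ : QDModel.X M₁ → QDModel.X M₂ → Set) → IsModalBisimConv M₁ M₂ ρ →
    ∀ {x₁ x₂} → ρ x₁ x₂ → (φ : Formula P) →
    (_⊨_ M₁ x₁ φ) ⇔ (_⊨_ M₂ x₂ φ)
theorem29 M₁ M₂ ρ B r φ = mk⇔ (preserve B r φ) (preserve (converse B) r φ)
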